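{- Let $p$ be an odd prime and $\lambda\in\mathbb{C}_p$ with $|\lambda|_p<p^{ -\frac{1}{p-1}}$. For every positive integer $k$, $$\mathcal{E}_{k,\lambda}=(1)_{k,\lambda}+\sum_{l=0}^{k-1}\binom{k}{l}(-1)^{k+l}(1)_{l,\lambda}\big(\mathcal{E}_{k-l,-\lambda}+2(1)_{k-l,-\lambda}\big).$$
   Context: $\mathbb{C}_p$ is the completion of the algebraic closure of $\mathbb{Q}_p$, with $|p|_p=1/p$. For $x,\mu\in\mathbb{C}_p$ define $(x)_{0,\mu}=1$ and $(x)_{n,\mu}=x(x-\mu)\cdots(x-(n-1)\mu)$ for $n\ge1$. For $\mu\in\mathbb{C}_p$ with $|\mu|_p<p^{ -\frac{1}{p-1}}$ (in particular $\mu=\pm\lambda$), the degenerate Euler numbers $\mathcal{E}_{n,\mu}$ are defined by $\frac{2}{(1+\mu t)^{1/\mu}+1}=\sum_{n\ge0}\mathcal{E}_{n,\mu}\frac{t^n}{n!}$. -}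

module Defs where

open import Level using (Level)
open import Data.Nat using (ℕ; zero; suc; _∸_)
open import Data.Nat.Combinatorics using (_C_)
open import Algebra.Bundles using (CommutativeRing)

module _ {c ℓ : Level} (R : CommutativeRing c ℓ) where
  open CommutativeRing R

  fromℕ : ℕ → Carrier
  fromℕ zero = 0#
  fromℕ (suc n) = 1# + fromℕ n

  sgn : ℕ → Carrier
  sgn zero = 1#
  sgn (suc n) = - sgn n

  ff : Carrier → Carrier → ℕ → Carrier
  ff μ x zero = 1#
  ff μ x (suc n) = ff μ x n * (x - fromℕ n * μ)

  Σ< : ℕ → (ℕ → Carrier) → Carrier
  Σ< zero f = 0#
  Σ< (suc n) f = Σ< n f + f n

  twoδ : ℕ → Carrier
  twoδ zero = 1# + 1#
  twoδ (suc n) = 0#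

  -- E is the sequence of degenerate Euler numbers E_{n,μ}, i.e.
  -- 2 / ((1+μt)^{1/μ} + 1) = Σ E n t^n/n!, written coefficientwise as
  -- ((1+μt)^{1/μ} + 1) · Σ E n t^n/n! = 2, using (1+μt)^{1/μ} = Σ (1)_{n,μ} t^n/n!:
  --   Σ_{l=0}^{n} C(n,l) (1)_{n-l,μ} E_l + E_n = 2 δ_{n,0}.
  IsDegEuler : Carrier → (ℕ → Carrier) → Set ℓ
  IsDegEuler μ E = ∀ n →
    Σ< (suc n) (λ l → fromℕ (n C l) * ff μ 1# (n ∸ l) * E l) + E n ≈ twoδ n

{-# OPTIONS --safe #-}
module Submission where

-- Write e(t) = Σ (1)_{n,λ} tⁿ/n! = (1 + λt)^{1/λ} and f(t) for the same series with -λ.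
-- Vandermonde's identity for degenerate falling factorials gives e(t) f(-t) = 1.
-- The defining relations are E_λ (e + 1) = 2 and E_{-λ} (f + 1) = 2; substituting
-- -t in the second and multiplying by e shows that D(t) = E_{-λ}(-t) satisfies
-- D (e + 1) = 2e, so (E_λ + D - 2)(e + 1) = 0. The constant term of e + 1 is the
-- unit 2, hence E_λ(t) + E_{-λ}(-t) = 2. For k ≥ 1 this gives
-- E_{k,λ} = -D_k = [D e]_k - 2e_k, and [D e]_k = [e (D + 2 f(-t))]_k because
-- e(t) f(-t) = 1. As (-1)^{k+l} = (-1)^{k-l}, the last convolution is the sum of
-- the theorem plus its term l = k, which is e_k (E_{0,-λ} + 2) = 3e_k.

open import Level using (Level)
open import Data.Nat using (ℕ; zero; suc; _∸_; _≤_; _<_)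
import Data.Nat as ℕ
import Data.Nat.Properties as ℕ
open import Data.Nat.Induction using (<-rec)
open import Data.Nat.Combinatorics using (_C_; nCk+nC[k+1]≡[n+1]C[k+1]; nCn≡1; k>n⇒nCk≡0)
open import Algebra.Bundles using (CommutativeRing)
import Algebra.Properties.Ring as RingProperties
import Algebra.Properties.CommutativeSemigroup as CommutativeSemigroupProperties
import Algebra.Solver.CommutativeMonoid as CommutativeMonoidSolver
open import Relation.Binary.PropositionalEquality as ≡ using (_≡_)
import Relation.Binary.Reasoning.Setoid as SetoidReasoning
open import Defs

module BinomialConvolution {c ℓ : Level} (R : CommutativeRing c ℓ) where
  open CommutativeRing R
  open RingProperties ring using (-‿distribˡ-*; -‿+-comm; -‿involutive)
  open SetoidReasoning setoid
  private
    module +-Props = CommutativeSemigroupProperties +-commutativeSemigroup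
    module *-Props = CommutativeSemigroupProperties *-commutativeSemigroup

  Seq : Set c
  Seq = ℕ → Carrier

  infix 4 _≋_
  _≋_ : Seq → Seq → Set ℓ
  a ≋ b = ∀ n → a n ≈ b n

  shift : Seq → Seq
  shift a n = a (suc n)

  0ₛ : Seq
  0ₛ _ = 0#

  δ : Seq
  δ zero = 1#
  δ (suc _) = 0#

  infixl 6 _⊞_
  _⊞_ : Seq → Seq → Seq
  (a ⊞ b) n = a n + b n

  infixr 7 _·_
  _·_ : Carrier → Seq → Seq
  (x · a) n = x * a n

  ⊟_ : Seq → Seq
  (⊟ a) n = - a n

  alt : Seq → Seq
  alt a n = sgn R n * a n

  -- Binomial convolution, i.e. the product of exponential generating functions:
  -- shift is differentiation, and the recursion is the Leibniz rule.
  infixl 7 _⋆_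
  _⋆_ : Seq → Seq → Seq
  (a ⋆ b) zero = a 0 * b 0
  (a ⋆ b) (suc n) = (shift a ⋆ b) n + (a ⋆ shift b) n

  shift-cong : ∀ {a b} → a ≋ b → shift a ≋ shift b
  shift-cong p n = p (suc n)

  ⋆-cong : ∀ {a a₁ b b₁} → a ≋ a₁ → b ≋ b₁ → a ⋆ b ≋ a₁ ⋆ b₁
  ⋆-cong p q zero = *-cong (p 0) (q 0)
  ⋆-cong p q (suc n) = +-cong (⋆-cong (shift-cong p) q n) (⋆-cong p (shift-cong q) n)

  ⋆-congˡ : ∀ {a b b₁} → b ≋ b₁ → a ⋆ b ≋ a ⋆ b₁
  ⋆-congˡ = ⋆-cong (λ _ → refl)

  ⋆-congʳ : ∀ {a a₁ b} → a ≋ a₁ → a ⋆ b ≋ a₁ ⋆ b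
  ⋆-congʳ p = ⋆-cong p (λ _ → refl)

  ⋆-comm : ∀ a b → a ⋆ b ≋ b ⋆ a
  ⋆-comm a b zero = *-comm (a 0) (b 0)
  ⋆-comm a b (suc n) =
    trans (+-cong (⋆-comm (shift a) b n) (⋆-comm a (shift b) n)) (+-comm _ _)

  ⋆-distribʳ-⊞ : ∀ a b d → (a ⊞ b) ⋆ d ≋ a ⋆ d ⊞ b ⋆ d
  ⋆-distribʳ-⊞ a b d zero = distribʳ (d 0) (a 0) (b 0)
  ⋆-distribʳ-⊞ a b d (suc n) = begin
    ((shift a ⊞ shift b) ⋆ d) n + ((a ⊞ b) ⋆ shift d) n
      ≈⟨ +-cong (⋆-distribʳ-⊞ (shift a) (shift b) d n) (⋆-distribʳ-⊞ a b (shift d) n) ⟩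
    ((shift a ⋆ d) n + (shift b ⋆ d) n) + ((a ⋆ shift d) n + (b ⋆ shift d) n)
      ≈⟨ +-Props.interchange _ _ _ _ ⟩
    (a ⋆ d) (suc n) + (b ⋆ d) (suc n) ∎

  ⋆-distribˡ-⊞ : ∀ a b d → d ⋆ (a ⊞ b) ≋ d ⋆ a ⊞ d ⋆ b
  ⋆-distribˡ-⊞ a b d n = begin
    (d ⋆ (a ⊞ b)) n        ≈⟨ ⋆-comm d (a ⊞ b) n ⟩
    ((a ⊞ b) ⋆ d) n        ≈⟨ ⋆-distribʳ-⊞ a b d n ⟩
    (a ⋆ d) n + (b ⋆ d) n  ≈⟨ +-cong (⋆-comm a d n) (⋆-comm b d n) ⟩
    (d ⋆ a) n + (d ⋆ b) n  ∎

  ⋆-·ˡ : ∀ x a b → (x · a) ⋆ b ≋ x · (a ⋆ b)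
  ⋆-·ˡ x a b zero = *-assoc x (a 0) (b 0)
  ⋆-·ˡ x a b (suc n) =
    trans (+-cong (⋆-·ˡ x (shift a) b n) (⋆-·ˡ x a (shift b) n)) (sym (distribˡ x _ _))

  ⋆-·ʳ : ∀ x a b → a ⋆ (x · b) ≋ x · (a ⋆ b)
  ⋆-·ʳ x a b n = trans (⋆-comm a (x · b) n) (trans (⋆-·ˡ x b a n) (*-congˡ (⋆-comm b a n)))

  ⋆-⊟ˡ : ∀ a b → (⊟ a) ⋆ b ≋ ⊟ (a ⋆ b)
  ⋆-⊟ˡ a b zero = sym (-‿distribˡ-* (a 0) (b 0))
  ⋆-⊟ˡ a b (suc n) = trans (+-cong (⋆-⊟ˡ (shift a) b n) (⋆-⊟ˡ a (shift b) n)) (-‿+-comm _ _)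

  ⋆-⊟ʳ : ∀ a b → a ⋆ (⊟ b) ≋ ⊟ (a ⋆ b)
  ⋆-⊟ʳ a b n = trans (⋆-comm a (⊟ b) n) (trans (⋆-⊟ˡ b a n) (-‿cong (⋆-comm b a n)))

  ⋆-zeroˡ : ∀ a → 0ₛ ⋆ a ≋ 0ₛ
  ⋆-zeroˡ a zero = zeroˡ (a 0)
  ⋆-zeroˡ a (suc n) = trans (+-cong (⋆-zeroˡ a n) (⋆-zeroˡ (shift a) n)) (+-identityˡ 0#)

  ⋆-identityˡ : ∀ a → δ ⋆ a ≋ a
  ⋆-identityˡ a zero = *-identityˡ (a 0)
  ⋆-identityˡ a (suc n) =
    trans (+-cong (⋆-zeroˡ a n) (⋆-identityˡ (shift a) n)) (+-identityˡ (a (suc n)))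

  ⋆-identityʳ : ∀ a → a ⋆ δ ≋ a
  ⋆-identityʳ a n = trans (⋆-comm a δ n) (⋆-identityˡ a n)

  ⋆-assoc : ∀ a b d → (a ⋆ b) ⋆ d ≋ a ⋆ (b ⋆ d)
  ⋆-assoc a b d zero = *-assoc (a 0) (b 0) (d 0)
  ⋆-assoc a b d (suc n) = begin
    ((shift a ⋆ b ⊞ a ⋆ shift b) ⋆ d) n + ((a ⋆ b) ⋆ shift d) n
      ≈⟨ +-cong (⋆-distribʳ-⊞ (shift a ⋆ b) (a ⋆ shift b) d n) (⋆-assoc a b (shift d) n) ⟩
    (((shift a ⋆ b) ⋆ d) n + ((a ⋆ shift b) ⋆ d) n) + (a ⋆ (b ⋆ shift d)) n
      ≈⟨ +-congʳ (+-cong (⋆-assoc (shift a) b d n) (⋆-assoc a (shift b) d n)) ⟩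
    ((shift a ⋆ (b ⋆ d)) n + (a ⋆ (shift b ⋆ d)) n) + (a ⋆ (b ⋆ shift d)) n
      ≈⟨ +-assoc _ _ _ ⟩
    (shift a ⋆ (b ⋆ d)) n + ((a ⋆ (shift b ⋆ d)) n + (a ⋆ (b ⋆ shift d)) n)
      ≈⟨ +-congˡ (sym (⋆-distribˡ-⊞ (shift b ⋆ d) (b ⋆ shift d) a n)) ⟩
    (a ⋆ (b ⋆ d)) (suc n) ∎

  sgn-+ : ∀ m n → sgn R (m ℕ.+ n) ≈ sgn R m * sgn R n
  sgn-+ zero n = sym (*-identityˡ _)
  sgn-+ (suc m) n = trans (-‿cong (sgn-+ m n)) (-‿distribˡ-* _ _)

  sgn-+-self : ∀ n → sgn R (n ℕ.+ n) ≈ 1#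
  sgn-+-self zero = refl
  sgn-+-self (suc n) rewrite ℕ.+-suc n n = trans (-‿involutive _) (sgn-+-self n)

  sgn-+≈sgn-∸ : ∀ {k l} → l ≤ k → sgn R (k ℕ.+ l) ≈ sgn R (k ∸ l)
  sgn-+≈sgn-∸ {k} {l} l≤k = begin
    sgn R (k ℕ.+ l)                  ≡⟨ ≡.cong (sgn R) k+l≡[k∸l]+[l+l] ⟩
    sgn R ((k ∸ l) ℕ.+ (l ℕ.+ l))    ≈⟨ sgn-+ (k ∸ l) (l ℕ.+ l) ⟩
    sgn R (k ∸ l) * sgn R (l ℕ.+ l)  ≈⟨ *-congˡ (sgn-+-self l) ⟩
    sgn R (k ∸ l) * 1#               ≈⟨ *-identityʳ _ ⟩
    sgn R (k ∸ l)                    ∎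
    where
    k+l≡[k∸l]+[l+l] : k ℕ.+ l ≡ (k ∸ l) ℕ.+ (l ℕ.+ l)
    k+l≡[k∸l]+[l+l] =
      ≡.trans (≡.cong (ℕ._+ l) (≡.sym (ℕ.m∸n+n≡m l≤k))) (ℕ.+-assoc (k ∸ l) l l)

  alt-suc : ∀ a → shift (alt a) ≋ ⊟ alt (shift a)
  alt-suc a n = sym (-‿distribˡ-* (sgn R n) (a (suc n)))

  alt-⋆ : ∀ a b → alt (a ⋆ b) ≋ alt a ⋆ alt b
  alt-⋆ a b zero = begin
    1# * (a 0 * b 0)         ≈⟨ *-identityˡ _ ⟩
    a 0 * b 0                ≈⟨ sym (*-cong (*-identityˡ (a 0)) (*-identityˡ (b 0))) ⟩
    (1# * a 0) * (1# * b 0)  ∎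
  alt-⋆ a b (suc n) = begin
    - sgn R n * ((shift a ⋆ b) n + (a ⋆ shift b) n)
      ≈⟨ sym (-‿distribˡ-* _ _) ⟩
    - (sgn R n * ((shift a ⋆ b) n + (a ⋆ shift b) n))
      ≈⟨ -‿cong (distribˡ _ _ _) ⟩
    - (alt (shift a ⋆ b) n + alt (a ⋆ shift b) n)
      ≈⟨ -‿cong (+-cong (alt-⋆ (shift a) b n) (alt-⋆ a (shift b) n)) ⟩
    - ((alt (shift a) ⋆ alt b) n + (alt a ⋆ alt (shift b)) n)
      ≈⟨ sym (-‿+-comm _ _) ⟩
    - (alt (shift a) ⋆ alt b) n + - (alt a ⋆ alt (shift b)) n
      ≈⟨ sym (+-cong (⋆-⊟ˡ (alt (shift a)) (alt b) n) (⋆-⊟ʳ (alt a) (alt (shift b)) n)) ⟩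
    ((⊟ alt (shift a)) ⋆ alt b) n + (alt a ⋆ (⊟ alt (shift b))) n
      ≈⟨ sym (+-cong (⋆-congʳ (alt-suc a) n) (⋆-congˡ (alt-suc b) n)) ⟩
    (alt a ⋆ alt b) (suc n) ∎

  fromℕ-+ : ∀ m n → fromℕ R (m ℕ.+ n) ≈ fromℕ R m + fromℕ R n
  fromℕ-+ zero n = sym (+-identityˡ _)
  fromℕ-+ (suc m) n = trans (+-congˡ (fromℕ-+ m n)) (sym (+-assoc _ _ _))

  Σ<-cong : ∀ n {a b : Seq} → (∀ l → l < n → a l ≈ b l) → Σ< R n a ≈ Σ< R n b
  Σ<-cong zero p = refl
  Σ<-cong (suc n) p = +-cong (Σ<-cong n (λ l l<n → p l (ℕ.m<n⇒m<1+n l<n))) (p n ℕ.≤-refl)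

  Σ<-⊞ : ∀ n a b → Σ< R n (a ⊞ b) ≈ Σ< R n a + Σ< R n b
  Σ<-⊞ zero a b = sym (+-identityˡ 0#)
  Σ<-⊞ (suc n) a b = trans (+-congʳ (Σ<-⊞ n a b)) (+-Props.interchange _ _ _ _)

  Σ<-suc : ∀ n a → Σ< R (suc n) a ≈ a 0 + Σ< R n (shift a)
  Σ<-suc zero a = trans (+-identityˡ _) (sym (+-identityʳ _))
  Σ<-suc (suc n) a = trans (+-congʳ (Σ<-suc n a)) (+-assoc _ _ _)

  binomialTerm : ℕ → Seq → Seq → Seq
  binomialTerm n a b l = fromℕ R (n C l) * a l * b (n ∸ l)

  binomialTerm-alt : ∀ {k l} a b → l ≤ k →
    fromℕ R (k C l) * sgn R (k ℕ.+ l) * a l * b (k ∸ l) ≈ binomialTerm k a (alt b) l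
  binomialTerm-alt {k} {l} a b l≤k = begin
    fromℕ R (k C l) * sgn R (k ℕ.+ l) * a l * b (k ∸ l)
      ≈⟨ *-congʳ (*-congʳ (*-congˡ (sgn-+≈sgn-∸ l≤k))) ⟩
    fromℕ R (k C l) * sgn R (k ∸ l) * a l * b (k ∸ l)
      ≈⟨ *-congʳ (*-Props.xy∙z≈xz∙y _ _ _) ⟩
    fromℕ R (k C l) * a l * sgn R (k ∸ l) * b (k ∸ l)
      ≈⟨ *-assoc _ _ _ ⟩
    binomialTerm k a (alt b) l ∎

  binomialSum : ℕ → Seq → Seq → Carrier
  binomialSum n a b = Σ< R (suc n) (binomialTerm n a b)

  binomialSum-last : ∀ n a b → binomialSum n a b ≈ Σ< R n (binomialTerm n a b) + a n * b 0
  binomialSum-last n a b rewrite nCn≡1 n | ℕ.n∸n≡0 n =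
    +-congˡ (*-congʳ (trans (*-congʳ (+-identityʳ 1#)) (*-identityˡ (a n))))

  binomialSum-suc : ∀ n a b →
    binomialSum (suc n) a b ≈ binomialSum n (shift a) b + binomialSum n a (shift b)
  binomialSum-suc n a b = begin
    Σ< R (suc (suc n)) U
      ≈⟨ Σ<-suc (suc n) U ⟩
    U 0 + Σ< R (suc n) (shift U)
      ≈⟨ +-congˡ (trans (Σ<-cong (suc n) (λ l _ → pascal l)) (Σ<-⊞ (suc n) _ _)) ⟩
    T 0 + (binomialSum n (shift a) b + Σ< R (suc n) (shift T))
      ≈⟨ +-Props.x∙yz≈y∙xz _ _ _ ⟩
    binomialSum n (shift a) b + (T 0 + Σ< R (suc n) (shift T))
      ≈⟨ +-congˡ (trans (sym (Σ<-suc (suc n) T)) T-trim) ⟩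
    binomialSum n (shift a) b + binomialSum n a (shift b) ∎
    where
    U T : Seq
    U = binomialTerm (suc n) a b
    T l = fromℕ R (n C l) * a l * b (suc n ∸ l)

    pascal : shift U ≋ binomialTerm n (shift a) b ⊞ shift T
    pascal l = begin
      fromℕ R (suc n C suc l) * a (suc l) * b (n ∸ l)
        ≈⟨ *-congʳ (*-congʳ (reflexive (≡.cong (fromℕ R) (≡.sym (nCk+nC[k+1]≡[n+1]C[k+1] n l))))) ⟩
      fromℕ R (n C l ℕ.+ n C suc l) * a (suc l) * b (n ∸ l)
        ≈⟨ *-congʳ (*-congʳ (fromℕ-+ (n C l) (n C suc l))) ⟩
      (fromℕ R (n C l) + fromℕ R (n C suc l)) * a (suc l) * b (n ∸ l)
        ≈⟨ trans (*-congʳ (distribʳ _ _ _)) (distribʳ _ _ _) ⟩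
      (binomialTerm n (shift a) b ⊞ shift T) l ∎

    T-beyond : T (suc n) ≈ 0#
    T-beyond rewrite k>n⇒nCk≡0 (ℕ.n<1+n n) = trans (*-congʳ (zeroˡ _)) (zeroˡ _)

    T-trim : Σ< R (suc (suc n)) T ≈ binomialSum n a (shift b)
    T-trim = begin
      Σ< R (suc n) T + T (suc n)
        ≈⟨ trans (+-congˡ T-beyond) (+-identityʳ _) ⟩
      Σ< R (suc n) T
        ≈⟨ Σ<-cong (suc n) (λ l l≤n → *-congˡ (reflexive (≡.cong b (suc-∸ (ℕ.≤-pred l≤n))))) ⟩
      binomialSum n a (shift b) ∎
      where
      suc-∸ : ∀ {l} → l ≤ n → suc n ∸ l ≡ suc (n ∸ l)
      suc-∸ = ℕ.+-∸-assoc 1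

  ⋆-binomial : ∀ a b n → (a ⋆ b) n ≈ binomialSum n a b
  ⋆-binomial a b zero = sym (trans (binomialSum-last 0 a b) (+-identityˡ _))
  ⋆-binomial a b (suc n) =
    trans (+-cong (⋆-binomial (shift a) b n) (⋆-binomial a (shift b) n))
          (sym (binomialSum-suc n a b))

module FallingFactorial {c ℓ : Level} (R : CommutativeRing c ℓ) where
  open CommutativeRing R
  open RingProperties ring using (-‿distribˡ-*; -‿distribʳ-*; -‿+-comm; -0#≈0#; -‿involutive)
  open SetoidReasoning setoid
  open BinomialConvolution R
  private
    module +-Props = CommutativeSemigroupProperties +-commutativeSemigroup

  ff-cong : ∀ μ n {x y} → x ≈ y → ff R μ x n ≈ ff R μ y n
  ff-cong μ zero p = refl
  ff-cong μ (suc n) p = *-cong (ff-cong μ n p) (+-congʳ p)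

  ff-sucˡ : ∀ μ x n → ff R μ x (suc n) ≈ x * ff R μ (x - μ) n
  ff-sucˡ μ x zero = begin
    1# * (x - 0# * μ)  ≈⟨ *-identityˡ _ ⟩
    x - 0# * μ         ≈⟨ +-congˡ (trans (-‿cong (zeroˡ μ)) -0#≈0#) ⟩
    x + 0#             ≈⟨ +-identityʳ x ⟩
    x                  ≈⟨ sym (*-identityʳ x) ⟩
    x * 1#             ∎
  ff-sucˡ μ x (suc n) = begin
    ff R μ x (suc n) * (x - (1# + fromℕ R n) * μ)
      ≈⟨ *-cong (ff-sucˡ μ x n) last-factor ⟩
    (x * ff R μ (x - μ) n) * ((x - μ) - fromℕ R n * μ)
      ≈⟨ *-assoc _ _ _ ⟩
    x * ff R μ (x - μ) (suc n) ∎
    where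
    last-factor : x - (1# + fromℕ R n) * μ ≈ (x - μ) - fromℕ R n * μ
    last-factor = begin
      x - (1# + fromℕ R n) * μ
        ≈⟨ +-congˡ (-‿cong (trans (distribʳ _ _ _) (+-congʳ (*-identityˡ μ)))) ⟩
      x - (μ + fromℕ R n * μ)    ≈⟨ +-congˡ (sym (-‿+-comm _ _)) ⟩
      x + (- μ - fromℕ R n * μ)  ≈⟨ sym (+-assoc _ _ _) ⟩
      (x - μ) - fromℕ R n * μ    ∎

  ff-vandermonde : ∀ μ x y → ff R μ x ⋆ ff R μ y ≋ ff R μ (x + y)
  ff-vandermonde μ x y zero = *-identityˡ 1#
  ff-vandermonde μ x y (suc n) = begin
    (shift (ff R μ x) ⋆ ff R μ y) n + (ff R μ x ⋆ shift (ff R μ y)) n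
      ≈⟨ +-cong (⋆-congʳ (ff-sucˡ μ x) n) (⋆-congˡ (ff-sucˡ μ y) n) ⟩
    ((x · ff R μ (x - μ)) ⋆ ff R μ y) n + (ff R μ x ⋆ (y · ff R μ (y - μ))) n
      ≈⟨ +-cong (⋆-·ˡ x _ _ n) (⋆-·ʳ y _ _ n) ⟩
    x * (ff R μ (x - μ) ⋆ ff R μ y) n + y * (ff R μ x ⋆ ff R μ (y - μ)) n
      ≈⟨ +-cong (*-congˡ (ff-vandermonde μ (x - μ) y n)) (*-congˡ (ff-vandermonde μ x (y - μ) n)) ⟩
    x * ff R μ ((x - μ) + y) n + y * ff R μ (x + (y - μ)) n
      ≈⟨ +-cong (*-congˡ (ff-cong μ n (+-Props.xy∙z≈xz∙y _ _ _)))
                (*-congˡ (ff-cong μ n (sym (+-assoc _ _ _)))) ⟩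
    x * ff R μ ((x + y) - μ) n + y * ff R μ ((x + y) - μ) n
      ≈⟨ sym (distribʳ _ _ _) ⟩
    (x + y) * ff R μ ((x + y) - μ) n
      ≈⟨ sym (ff-sucˡ μ (x + y) n) ⟩
    ff R μ (x + y) (suc n) ∎

  alt-ff : ∀ μ x → alt (ff R (- μ) x) ≋ ff R μ (- x)
  alt-ff μ x zero = *-identityˡ 1#
  alt-ff μ x (suc n) = begin
    - sgn R n * (ff R (- μ) x n * (x - fromℕ R n * - μ))
      ≈⟨ sym (-‿distribˡ-* _ _) ⟩
    - (sgn R n * (ff R (- μ) x n * (x - fromℕ R n * - μ)))
      ≈⟨ -‿cong (sym (*-assoc _ _ _)) ⟩
    - (alt (ff R (- μ) x) n * (x - fromℕ R n * - μ))
      ≈⟨ -‿distribʳ-* _ _ ⟩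
    alt (ff R (- μ) x) n * - (x - fromℕ R n * - μ)
      ≈⟨ *-cong (alt-ff μ x n) negated-factor ⟩
    ff R μ (- x) (suc n) ∎
    where
    negated-factor : - (x - fromℕ R n * - μ) ≈ - x - fromℕ R n * μ
    negated-factor = begin
      - (x - fromℕ R n * - μ)
        ≈⟨ -‿cong (+-congˡ (trans (-‿cong (sym (-‿distribʳ-* _ _))) (-‿involutive _))) ⟩
      - (x + fromℕ R n * μ)    ≈⟨ sym (-‿+-comm _ _) ⟩
      - x - fromℕ R n * μ      ∎

  ff-zero : ∀ μ → ff R μ 0# ≋ δ
  ff-zero μ zero = refl
  ff-zero μ (suc zero) = trans (ff-sucˡ μ 0# 0) (zeroˡ _)
  ff-zero μ (suc (suc n)) = trans (*-congʳ (ff-zero μ (suc n))) (zeroˡ _)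

  ff⋆alt-ff : ∀ μ → ff R μ 1# ⋆ alt (ff R (- μ) 1#) ≋ δ
  ff⋆alt-ff μ n = begin
    (ff R μ 1# ⋆ alt (ff R (- μ) 1#)) n  ≈⟨ ⋆-congˡ (alt-ff μ 1#) n ⟩
    (ff R μ 1# ⋆ ff R μ (- 1#)) n        ≈⟨ ff-vandermonde μ 1# (- 1#) n ⟩
    ff R μ (1# - 1#) n                   ≈⟨ ff-cong μ n (-‿inverseʳ 1#) ⟩
    ff R μ 0# n                          ≈⟨ ff-zero μ n ⟩
    δ n                                  ∎

module DegenerateEuler {c ℓ : Level} (R : CommutativeRing c ℓ) where
  open CommutativeRing R
  open RingProperties ring using (+-cancelˡ; +-cancelʳ)
  open SetoidReasoning setoid
  open BinomialConvolution R
  open FallingFactorial R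
  private
    module +-Props = CommutativeSemigroupProperties +-commutativeSemigroup
    module *-Props = CommutativeSemigroupProperties *-commutativeSemigroup
    module +-Solver = CommutativeMonoidSolver +-commutativeMonoid

  twoδ≋δ⊞δ : twoδ R ≋ δ ⊞ δ
  twoδ≋δ⊞δ zero = refl
  twoδ≋δ⊞δ (suc n) = sym (+-identityˡ 0#)

  twoδ-⋆ : ∀ a → twoδ R ⋆ a ≋ a ⊞ a
  twoδ-⋆ a n = begin
    (twoδ R ⋆ a) n         ≈⟨ ⋆-congʳ twoδ≋δ⊞δ n ⟩
    ((δ ⊞ δ) ⋆ a) n        ≈⟨ ⋆-distribʳ-⊞ δ δ a n ⟩
    (δ ⋆ a) n + (δ ⋆ a) n  ≈⟨ +-cong (⋆-identityˡ a n) (⋆-identityˡ a n) ⟩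
    a n + a n              ∎

  alt-twoδ : alt (twoδ R) ≋ twoδ R
  alt-twoδ zero = *-identityˡ _
  alt-twoδ (suc n) = zeroʳ _

  isDegEuler⇒⋆ : ∀ {μ E} → IsDegEuler R μ E → E ⋆ ff R μ 1# ⊞ E ≋ twoδ R
  isDegEuler⇒⋆ {μ} {E} isE n = trans (+-congʳ E⋆ff≈Σ) (isE n)
    where
    E⋆ff≈Σ : (E ⋆ ff R μ 1#) n ≈
             Σ< R (suc n) (λ l → fromℕ R (n C l) * ff R μ 1# (n ∸ l) * E l)
    E⋆ff≈Σ = trans (⋆-binomial E (ff R μ 1#) n)
                   (Σ<-cong (suc n) (λ l _ → *-Props.xy∙z≈xz∙y _ _ _))

  alt-isDegEuler : ∀ {μ E} → IsDegEuler R (- μ) E →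
    alt E ⋆ alt (ff R (- μ) 1#) ⊞ alt E ≋ twoδ R
  alt-isDegEuler {μ} {E} isE n = begin
    (alt E ⋆ alt (ff R (- μ) 1#)) n + alt E n  ≈⟨ +-congʳ (sym (alt-⋆ E (ff R (- μ) 1#) n)) ⟩
    alt (E ⋆ ff R (- μ) 1#) n + alt E n        ≈⟨ sym (distribˡ _ _ _) ⟩
    alt (E ⋆ ff R (- μ) 1# ⊞ E) n              ≈⟨ *-congˡ (isDegEuler⇒⋆ isE n) ⟩
    alt (twoδ R) n                             ≈⟨ alt-twoδ n ⟩
    twoδ R n                                   ∎

  -- alt-isDegEuler multiplied by ff μ 1#, the ⋆-inverse of alt (ff (- μ) 1#).
  alt-isDegEuler-dual : ∀ {μ E} → IsDegEuler R (- μ) E →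
    alt E ⊞ alt E ⋆ ff R μ 1# ≋ ff R μ 1# ⊞ ff R μ 1#
  alt-isDegEuler-dual {μ} {E} isE n = begin
    D n + (D ⋆ e) n                  ≈⟨ +-congʳ (sym (⋆-identityʳ D n)) ⟩
    (D ⋆ δ) n + (D ⋆ e) n            ≈⟨ +-congʳ (⋆-congˡ δ≋alt-f⋆e n) ⟩
    (D ⋆ (alt f ⋆ e)) n + (D ⋆ e) n  ≈⟨ +-congʳ (sym (⋆-assoc D (alt f) e n)) ⟩
    ((D ⋆ alt f) ⋆ e) n + (D ⋆ e) n  ≈⟨ sym (⋆-distribʳ-⊞ (D ⋆ alt f) D e n) ⟩
    ((D ⋆ alt f ⊞ D) ⋆ e) n          ≈⟨ ⋆-congʳ (alt-isDegEuler isE) n ⟩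
    (twoδ R ⋆ e) n                   ≈⟨ twoδ-⋆ e n ⟩
    e n + e n                        ∎
    where
    D e f : Seq
    D = alt E
    e = ff R μ 1#
    f = ff R (- μ) 1#
    δ≋alt-f⋆e : δ ≋ alt f ⋆ e
    δ≋alt-f⋆e m = sym (trans (⋆-comm (alt f) e m) (ff⋆alt-ff μ m))

  alt-⊞-· : ∀ x a b → alt (a ⊞ x · b) ≋ alt a ⊞ x · alt b
  alt-⊞-· x a b n = trans (distribˡ _ _ _) (+-congˡ (*-Props.x∙yz≈y∙xz _ _ _))

  ff⋆alt-⊞-ff : ∀ μ x E →
    ff R μ 1# ⋆ alt (E ⊞ x · ff R (- μ) 1#) ≋ ff R μ 1# ⋆ alt E ⊞ x · δ
  ff⋆alt-⊞-ff μ x E n = begin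
    (e ⋆ alt (E ⊞ x · f)) n              ≈⟨ ⋆-congˡ (alt-⊞-· x E f) n ⟩
    (e ⋆ (alt E ⊞ x · alt f)) n          ≈⟨ ⋆-distribˡ-⊞ (alt E) (x · alt f) e n ⟩
    (e ⋆ alt E) n + (e ⋆ (x · alt f)) n  ≈⟨ +-congˡ (⋆-·ʳ x e (alt f) n) ⟩
    (e ⋆ alt E) n + x * (e ⋆ alt f) n    ≈⟨ +-congˡ (*-congˡ (ff⋆alt-ff μ n)) ⟩
    (e ⋆ alt E) n + x * δ n              ∎
    where
    e f : Seq
    e = ff R μ 1#
    f = ff R (- μ) 1#

  module _ (half : Carrier) (half+half≈1 : half + half ≈ 1#) where

    +-double-injective : ∀ {x y} → x + x ≈ y + y → x ≈ y
    +-double-injective {x} {y} x+x≈y+y = begin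
      x                    ≈⟨ sym (trans (*-congʳ half+half≈1) (*-identityˡ x)) ⟩
      (half + half) * x    ≈⟨ distribʳ x half half ⟩
      half * x + half * x  ≈⟨ sym (distribˡ half x x) ⟩
      half * (x + x)       ≈⟨ *-congˡ x+x≈y+y ⟩
      half * (y + y)       ≈⟨ distribˡ half y y ⟩
      half * y + half * y  ≈⟨ sym (distribʳ y half half) ⟩
      (half + half) * y    ≈⟨ trans (*-congʳ half+half≈1) (*-identityˡ y) ⟩
      y                    ∎

    isDegEuler-head : ∀ {μ E} → IsDegEuler R μ E → E 0 ≈ 1#
    isDegEuler-head {E = E} isE =
      +-double-injective (trans (+-congʳ (sym (*-identityʳ (E 0)))) (isDegEuler⇒⋆ isE 0))

    -- By strong induction: the n-th coefficient of X ⋆ a ⊞ X is 2 X n plus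
    -- a combination of the lower coefficients of X.
    ⋆⊞-injective : ∀ {a X Y} → a 0 ≈ 1# → X ⋆ a ⊞ X ≋ Y ⋆ a ⊞ Y → X ≋ Y
    ⋆⊞-injective {a} {X} {Y} a0≈1 eq = <-rec (λ n → X n ≈ Y n) step
      where
      split : ∀ Z n → (Z ⋆ a ⊞ Z) n ≈ Σ< R n (binomialTerm n Z a) + (Z n + Z n)
      split Z n = begin
        (Z ⋆ a) n + Z n
          ≈⟨ +-congʳ (trans (⋆-binomial Z a n) (binomialSum-last n Z a)) ⟩
        (Σ< R n (binomialTerm n Z a) + Z n * a 0) + Z n
          ≈⟨ +-congʳ (+-congˡ (trans (*-congˡ a0≈1) (*-identityʳ (Z n)))) ⟩
        (Σ< R n (binomialTerm n Z a) + Z n) + Z n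
          ≈⟨ +-assoc _ _ _ ⟩
        Σ< R n (binomialTerm n Z a) + (Z n + Z n) ∎

      step : ∀ n → (∀ {m} → m < n → X m ≈ Y m) → X n ≈ Y n
      step n ih = +-double-injective (+-cancelˡ (Σ< R n (binomialTerm n X a)) _ _ (begin
        Σ< R n (binomialTerm n X a) + (X n + X n)  ≈⟨ sym (split X n) ⟩
        (X ⋆ a ⊞ X) n                              ≈⟨ eq n ⟩
        (Y ⋆ a ⊞ Y) n                              ≈⟨ split Y n ⟩
        Σ< R n (binomialTerm n Y a) + (Y n + Y n)  ≈⟨ +-congʳ (Σ<-cong n lower-terms) ⟩
        Σ< R n (binomialTerm n X a) + (Y n + Y n)  ∎))
        where
        lower-terms : ∀ l → l < n → binomialTerm n Y a l ≈ binomialTerm n X a l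
        lower-terms l l<n = *-congʳ (*-congˡ (sym (ih l<n)))

    isDegEuler-⊞-alt : ∀ {μ E⁺ E⁻} → IsDegEuler R μ E⁺ → IsDegEuler R (- μ) E⁻ →
      E⁺ ⊞ alt E⁻ ≋ twoδ R
    isDegEuler-⊞-alt {μ} {E⁺} {E⁻} isE⁺ isE⁻ = ⋆⊞-injective refl same-image
      where
      e D : Seq
      e = ff R μ 1#
      D = alt E⁻
      same-image : (E⁺ ⊞ D) ⋆ e ⊞ (E⁺ ⊞ D) ≋ twoδ R ⋆ e ⊞ twoδ R
      same-image n = begin
        ((E⁺ ⊞ D) ⋆ e) n + (E⁺ n + D n)
          ≈⟨ +-congʳ (⋆-distribʳ-⊞ E⁺ D e n) ⟩
        ((E⁺ ⋆ e) n + (D ⋆ e) n) + (E⁺ n + D n)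
          ≈⟨ +-Props.interchange _ _ _ _ ⟩
        ((E⁺ ⋆ e) n + E⁺ n) + ((D ⋆ e) n + D n)
          ≈⟨ +-cong (isDegEuler⇒⋆ isE⁺ n) (trans (+-comm _ _) (alt-isDegEuler-dual isE⁻ n)) ⟩
        twoδ R n + (e n + e n)
          ≈⟨ trans (+-comm _ _) (+-congʳ (sym (twoδ-⋆ e n))) ⟩
        (twoδ R ⋆ e) n + twoδ R n ∎

    E⁺-expansion : ∀ {μ E⁺ E⁻} → IsDegEuler R μ E⁺ → IsDegEuler R (- μ) E⁻ → ∀ k →
      E⁺ (suc k) ≈ ff R μ 1# (suc k) + Σ< R (suc k)
        (binomialTerm (suc k) (ff R μ 1#) (alt (E⁻ ⊞ (1# + 1#) · ff R (- μ) 1#)))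
    E⁺-expansion {μ} {E⁺} {E⁻} isE⁺ isE⁻ k = +-cancelʳ (D K + (e K + e K)) _ _ (begin
      E⁺ K + (D K + (e K + e K))       ≈⟨ sym (+-assoc _ _ _) ⟩
      (E⁺ K + D K) + (e K + e K)       ≈⟨ +-congʳ (isDegEuler-⊞-alt isE⁺ isE⁻ K) ⟩
      0# + (e K + e K)                 ≈⟨ +-identityˡ _ ⟩
      e K + e K                        ≈⟨ sym (alt-isDegEuler-dual isE⁻ K) ⟩
      D K + (D ⋆ e) K                  ≈⟨ +-congˡ (⋆-comm D e K) ⟩
      D K + (e ⋆ D) K                  ≈⟨ +-congˡ (sym e⋆G≈e⋆D) ⟩
      D K + (e ⋆ G) K                  ≈⟨ +-congˡ (trans (⋆-binomial e G K) (binomialSum-last K e G)) ⟩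
      D K + (S + e K * G 0)            ≈⟨ +-congˡ (+-congˡ eG0≈3e) ⟩
      D K + (S + (e K + (e K + e K)))  ≈⟨ rearrange (D K) S (e K) ⟩
      (e K + S) + (D K + (e K + e K))  ∎)
      where
      K = suc k
      e D G : Seq
      e = ff R μ 1#
      D = alt E⁻
      G = alt (E⁻ ⊞ (1# + 1#) · ff R (- μ) 1#)
      S = Σ< R K (binomialTerm K e G)

      e⋆G≈e⋆D : (e ⋆ G) K ≈ (e ⋆ D) K
      e⋆G≈e⋆D = trans (ff⋆alt-⊞-ff μ (1# + 1#) E⁻ K) (trans (+-congˡ (zeroʳ _)) (+-identityʳ _))

      eG0≈3e : e K * G 0 ≈ e K + (e K + e K)
      eG0≈3e = begin
        e K * (1# * (E⁻ 0 + (1# + 1#) * 1#))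
          ≈⟨ *-congˡ (trans (*-identityˡ _) (+-cong (isDegEuler-head isE⁻) (*-identityʳ _))) ⟩
        e K * (1# + (1# + 1#))
          ≈⟨ trans (distribˡ _ _ _) (+-cong (*-identityʳ _) (distribˡ _ _ _)) ⟩
        e K + (e K * 1# + e K * 1#)
          ≈⟨ +-congˡ (+-cong (*-identityʳ _) (*-identityʳ _)) ⟩
        e K + (e K + e K) ∎

      rearrange : ∀ d s x → d + (s + (x + (x + x))) ≈ (x + s) + (d + (x + x))
      rearrange = +-Solver.solve 3
        (λ d s x → d ⊕ (s ⊕ (x ⊕ (x ⊕ x))) ⊜ (x ⊕ s) ⊕ (d ⊕ (x ⊕ x))) refl
        where open +-Solver using (_⊕_; _⊜_)

open import Data.Nat using (_+_)

theorem2p10 : ∀ {c ℓ} (R : CommutativeRing c ℓ) →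
    let open CommutativeRing R renaming (_+_ to _+R_) in
    (half : Carrier) → half +R half ≈ 1# →
    (lam : Carrier) (E⁺ E⁻ : ℕ → Carrier) →
    IsDegEuler R lam E⁺ → IsDegEuler R (- lam) E⁻ →
    (k : ℕ) → 1 ≤ k →
    E⁺ k ≈ ff R lam 1# k +R
      Σ< R k (λ l → fromℕ R (k C l) * sgn R (k + l) * ff R lam 1# l
                      * (E⁻ (k ∸ l) +R (1# +R 1#) * ff R (- lam) 1# (k ∸ l)))
theorem2p10 R half half+half≈1 lam E⁺ E⁻ isE⁺ isE⁻ (suc k) _ =
  trans (E⁺-expansion half half+half≈1 isE⁺ isE⁻ k)
        (+-congˡ (sym (Σ<-cong (suc k) (λ l l<1+k → binomialTerm-alt e W (ℕ.<⇒≤ l<1+k)))))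
  where
  open CommutativeRing R using (trans; sym; +-congˡ; 1#; -_) renaming (_+_ to _+R_)
  open BinomialConvolution R
  open DegenerateEuler R
  e W : Seq
  e = ff R lam 1#
  W = E⁻ ⊞ (1# +R 1#) · ff R (- lam) 1#
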